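{- Let $H$ be a graph with $o(H)=\mathcal{D}$. Then $\gamma_{\mathrm{MB}}(K_2\odot H)=1+\gamma_{\mathrm{MB}}(H)$.
   Context: All graphs are finite and simple; $K_2$ is the complete graph on two vertices. The Maker-Breaker domination game on a graph $G$: Dominator and Staller alternately select a not yet selected vertex of $G$. Dominator wins if his selected vertices contain a dominating set of $G$; Staller wins if she selects at least one vertex from every dominating set of $G$. In the D-game Dominator moves first, in the S-game Staller moves first. $\gamma_{\mathrm{MB}}(G)$ is the minimum number of moves Dominator needs to win the D-game on $G$ when both players play optimally ($\infty$ if he has no winning strategy). The outcome $o(H)=\mathcal{D}$ means Dominator has a winning strategy in both the D-game and the S-game on $H$. The corona $G\odot H$ is obtained from one copy of $G$ and $n(G)$ disjoint copies of $H$ by joining the $i$-th vertex of $G$ to every vertex of the $i$-th copy of $H$. -}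

module Defs where

open import Data.Nat using (ℕ; zero; suc; _+_; _*_; _≤_)
open import Data.Bool using (Bool; true; false; not; _∧_)
open import Data.Fin using (Fin; splitAt; remQuot; _≟_)
open import Data.Fin.Subset using (Subset; _∈_; _∉_; _⊆_; _∪_; ⁅_⁆) renaming (⊥ to ∅)
open import Data.Sum using (_⊎_; inj₁; inj₂)
open import Data.Product using (Σ; ∃; _×_; _,_)
open import Relation.Nullary using (¬_)
open import Relation.Nullary.Decidable using (⌊_⌋)
open import Relation.Binary.PropositionalEquality using (_≡_)

record Graph : Set where
  constructor mkGraph
  field
    n   : ℕ
    adj : Fin n → Fin n → Bool
open Graph public

Adj : (G : Graph) → Fin (n G) → Fin (n G) → Set
Adj G u v = adj G u v ≡ true

IsSimple : Graph → Set
IsSimple G = (∀ u v → adj G u v ≡ adj G v u) × (∀ v → adj G v v ≡ false)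

Dominating : (G : Graph) → Subset (n G) → Set
Dominating G X = ∀ v → v ∈ X ⊎ (∃ λ u → u ∈ X × Adj G u v)

DomWon : (G : Graph) → Subset (n G) → Set
DomWon G D = ∃ λ X → Dominating G X × X ⊆ D

-- DWinD G k D S : in the position where Dominator has selected D, Staller S,
--   and it is Dominator's turn, Dominator can force a win using at most k
--   further moves of his own.
-- DWinS G k D S : same, but Staller is to move.
data DWinD (G : Graph) : ℕ → Subset (n G) → Subset (n G) → Set
data DWinS (G : Graph) : ℕ → Subset (n G) → Subset (n G) → Set

data DWinD G where
  won  : ∀ {k D S} → DomWon G D → DWinD G k D S
  move : ∀ {k D S} (v : Fin (n G)) → v ∉ D → v ∉ S →
         DWinS G k (D ∪ ⁅ v ⁆) S → DWinD G (suc k) D S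

data DWinS G where
  won  : ∀ {k D S} → DomWon G D → DWinS G k D S
  resp : ∀ {k D S} →
         (∃ λ v → v ∉ D × v ∉ S) →
         (∀ v → v ∉ D → v ∉ S → DWinD G k D (S ∪ ⁅ v ⁆)) →
         DWinS G k D S

IsGammaMB : Graph → ℕ → Set
IsGammaMB G k = DWinD G k ∅ ∅ × (∀ j → DWinD G j ∅ ∅ → k ≤ j)

-- o(G) = 𝒟 : Dominator wins both the D-game and the S-game
OutcomeD : Graph → Set
OutcomeD G = (∃ λ k → DWinD G k ∅ ∅) × (∃ λ k → DWinS G k ∅ ∅)

_==_ : ∀ {m} → Fin m → Fin m → Bool
i == j = ⌊ i ≟ j ⌋

K₂ : Graph
K₂ = mkGraph 2 (λ i j → not (i == j))

-- corona G ⊙ H: vertex set Fin (n G + n G * n H); the first n G vertices are G,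
-- vertex combine i h of the second block is vertex h of the i-th copy of H.
coronaAdj : (G H : Graph) → Fin (n G + n G * n H) → Fin (n G + n G * n H) → Bool
coronaAdj G H x y with splitAt (n G) x | splitAt (n G) y
... | inj₁ i | inj₁ j = adj G i j
... | inj₁ i | inj₂ q with remQuot {n G} (n H) q
...   | (j , _) = i == j
coronaAdj G H x y | inj₂ p | inj₁ j with remQuot {n G} (n H) p
...   | (i , _) = i == j
coronaAdj G H x y | inj₂ p | inj₂ q with remQuot {n G} (n H) p | remQuot {n G} (n H) q
...   | (i , h) | (j , h') = (i == j) ∧ adj H h h'

_⊙_ : Graph → Graph → Graph
G ⊙ H = mkGraph (n G + n G * n H) (coronaAdj G H)

{-# OPTIONS --safe #-}
module Submission where

-- Write x_c (centre c) for the vertices of K₂ and H_c (copy c) for the copy of H attached to x_c.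
--
-- Upper bound: Dominator claims x₀, which dominates x₁ and H₀.  If Staller answers x₁, the
-- vertices of H₁ can only be dominated from inside H₁, where Dominator follows his optimal
-- D-game strategy on H, treating Staller's moves elsewhere as passes.  Otherwise Dominator
-- claims x₁, and x₀, x₁ dominate everything; two moves are within 1 + γ_MB(H) because
-- γ_MB(H) = 0 only for the empty graph, where x₀ alone dominates.
--
-- Lower bound: after Dominator's first move, Staller claims a centre x_c such that neither x_c
-- nor H_c was touched by that move.  From then on H_c can only be dominated from inside, so the
-- trace of the play on H_c is a won D-game on H; Dominator's moves outside H_c are wasted there.

open import Defs
open import Data.Nat using (ℕ; zero; suc; _*_; _≤_; s≤s)
open import Data.Nat.Properties using (n≤1+n)
open import Data.Bool using (true; _∧_)
open import Data.Bool.Properties using (∧-conicalˡ; ∧-conicalʳ)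
open import Data.Empty using (⊥-elim)
open import Data.Fin using (Fin; suc; _↑ˡ_; _↑ʳ_; combine; remQuot; _≟_)
open import Data.Fin.Patterns using (0F; 1F)
open import Data.Fin.Properties
  using (remQuot-combine; combine-remQuot; ↑ʳ-injective; combine-injectiveˡ; combine-injectiveʳ; any?)
open import Data.Fin.Subset using (Subset; _∈_; _∉_; _⊆_; _∪_; _∩_; ⁅_⁆) renaming (⊥ to ∅)
open import Data.Fin.Subset.Properties
  using (_∈?_; ∉⊥; ⊥⊆; ⊆-antisym; p⊆p∪q; p∩q⊆p; p∩q⊆q; x∈⁅x⁆; x∈⁅y⁆⇒x≡y; x∈p∪q⁻; x∈p∪q⁺; x∈p∩q⁺)
open import Data.Vec using (tabulate; lookup)
open import Data.Vec.Properties using (lookup∘tabulate; []=⇒lookup; lookup⇒[]=)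
open import Data.Sum using (_⊎_; inj₁; inj₂; [_,_])
open import Data.Product using (∃; _×_; _,_; proj₁; proj₂; uncurry)
open import Function using (_∘_; id)
open import Relation.Nullary using (¬_; yes; no; ¬?)
open import Relation.Nullary.Decidable using (_×-dec_)
open import Relation.Binary.PropositionalEquality
  using (_≡_; _≢_; refl; sym; trans; cong; cong₂; subst; subst₂)

module _ {k : ℕ} where

  ∈∧∉⇒≢ : ∀ {x y : Fin k} {p} → x ∈ p → y ∉ p → x ≢ y
  ∈∧∉⇒≢ x∈p y∉p refl = y∉p x∈p

  x∈p∪⁅x⁆ : ∀ p (x : Fin k) → x ∈ p ∪ ⁅ x ⁆
  x∈p∪⁅x⁆ p x = x∈p∪q⁺ {p = p} (inj₂ (x∈⁅x⁆ x))

  ∉-∪⁅⁆ : ∀ {x v : Fin k} {p} → x ∉ p → x ≢ v → x ∉ p ∪ ⁅ v ⁆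
  ∉-∪⁅⁆ {v = v} {p} x∉p x≢v = [ x∉p , x≢v ∘ x∈⁅y⁆⇒x≡y v ] ∘ x∈p∪q⁻ p ⁅ v ⁆

  ∪⁅⁆-least : ∀ {p q} {x : Fin k} → p ⊆ q → x ∈ q → p ∪ ⁅ x ⁆ ⊆ q
  ∪⁅⁆-least {p} {x = x} p⊆q x∈q y∈ with x∈p∪q⁻ p ⁅ x ⁆ y∈
  ... | inj₁ y∈p = p⊆q y∈p
  ... | inj₂ y∈x rewrite x∈⁅y⁆⇒x≡y x y∈x = x∈q

module _ {k l : ℕ} (f : Fin k → Fin l) where

  preimage : Subset l → Subset k
  preimage p = tabulate (λ i → lookup p (f i))

  ∈-preimage⁺ : ∀ {p i} → f i ∈ p → i ∈ preimage p
  ∈-preimage⁺ {i = i} fi∈p = lookup⇒[]= i _ (trans (lookup∘tabulate _ i) ([]=⇒lookup fi∈p))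

  ∈-preimage⁻ : ∀ {p i} → i ∈ preimage p → f i ∈ p
  ∈-preimage⁻ {p} {i} i∈ =
    lookup⇒[]= (f i) p (trans (sym (lookup∘tabulate _ i)) ([]=⇒lookup i∈))

  preimage-mono : ∀ {p q} → p ⊆ q → preimage p ⊆ preimage q
  preimage-mono {p} p⊆q = ∈-preimage⁺ ∘ p⊆q ∘ ∈-preimage⁻ {p}

  preimage-∅ : preimage ∅ ≡ ∅
  preimage-∅ = ⊆-antisym (⊥-elim ∘ ∉⊥ ∘ ∈-preimage⁻) ⊥⊆

  preimage-∪-outside : ∀ p {v} → (∀ i → f i ≢ v) → preimage (p ∪ ⁅ v ⁆) ≡ preimage p
  preimage-∪-outside p {v} v∉im = ⊆-antisym shrink (preimage-mono {p} (p⊆p∪q ⁅ v ⁆))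
    where
    shrink : preimage (p ∪ ⁅ v ⁆) ⊆ preimage p
    shrink {i} i∈ with x∈p∪q⁻ p ⁅ v ⁆ (∈-preimage⁻ i∈)
    ... | inj₁ fi∈p = ∈-preimage⁺ fi∈p
    ... | inj₂ fi∈v = ⊥-elim (v∉im i (x∈⁅y⁆⇒x≡y v fi∈v))

  preimage-∪-image : (∀ {i j} → f i ≡ f j → i ≡ j) →
                     ∀ p i → preimage (p ∪ ⁅ f i ⁆) ≡ preimage p ∪ ⁅ i ⁆
  preimage-∪-image f-injective p i = ⊆-antisym shrink grow
    where
    shrink : preimage (p ∪ ⁅ f i ⁆) ⊆ preimage p ∪ ⁅ i ⁆
    shrink {j} j∈ with x∈p∪q⁻ p ⁅ f i ⁆ (∈-preimage⁻ j∈)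
    ... | inj₁ fj∈p = p⊆p∪q ⁅ i ⁆ (∈-preimage⁺ fj∈p)
    ... | inj₂ fj∈fi rewrite f-injective (x∈⁅y⁆⇒x≡y (f i) fj∈fi) = x∈p∪⁅x⁆ (preimage p) i
    grow : preimage p ∪ ⁅ i ⁆ ⊆ preimage (p ∪ ⁅ f i ⁆)
    grow = ∪⁅⁆-least (preimage-mono {p} (p⊆p∪q ⁅ f i ⁆)) (∈-preimage⁺ (x∈p∪⁅x⁆ p (f i)))

  preimage-⁅outside⁆ : ∀ {v} → (∀ i → f i ≢ v) → preimage (∅ ∪ ⁅ v ⁆) ≡ ∅
  preimage-⁅outside⁆ v∉im = trans (preimage-∪-outside ∅ v∉im) preimage-∅

==⇒≡ : ∀ {m} {i j : Fin m} → (i == j) ≡ true → i ≡ j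
==⇒≡ {i = i} {j} eq with i ≟ j
... | yes i≡j = i≡j
==⇒≡ () | no _

==-refl : ∀ {m} (i : Fin m) → (i == i) ≡ true
==-refl i with i ≟ i
... | yes _ = refl
... | no i≢i = ⊥-elim (i≢i refl)

module _ (G : Graph) where

  Dominating-mono : ∀ {X Y} → X ⊆ Y → Dominating G X → Dominating G Y
  Dominating-mono X⊆Y dom v with dom v
  ... | inj₁ v∈X = inj₁ (X⊆Y v∈X)
  ... | inj₂ (u , u∈X , u~v) = inj₂ (u , X⊆Y u∈X , u~v)

  DomWon⇒Dominating : ∀ {D} → DomWon G D → Dominating G D
  DomWon⇒Dominating (X , dom , X⊆D) = Dominating-mono X⊆D dom

  Dominating⇒DomWon : ∀ {D} → Dominating G D → DomWon G D
  Dominating⇒DomWon {D} dom = D , dom , id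

  ¬Dominating-∅ : Fin (n G) → ¬ Dominating G ∅
  ¬Dominating-∅ v dom with dom v
  ... | inj₁ v∈∅ = ∉⊥ v∈∅
  ... | inj₂ (_ , u∈∅ , _) = ∉⊥ u∈∅

  -- In a real play D and S are disjoint, and then this says that some dominating set avoids S.
  StallerNotWon : Subset (n G) → Subset (n G) → Set
  StallerNotWon D S = ∃ λ X → Dominating G X × X ∩ S ⊆ D

module _ {G : Graph} where

  DWinD-antimono : ∀ {k D S₀ S} → S₀ ⊆ S → DWinD G k D S → DWinD G k D S₀
  DWinS-antimono : ∀ {k D S₀ S} → S₀ ⊆ S → DWinS G k D S → DWinS G k D S₀
  DWinD-antimono _ (won w) = won w
  DWinD-antimono S₀⊆S (move v v∉D v∉S t) = move v v∉D (v∉S ∘ S₀⊆S) (DWinS-antimono S₀⊆S t)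
  DWinS-antimono _ (won w) = won w
  DWinS-antimono {k} {D} {S₀} {S} S₀⊆S (resp (z , z∉D , z∉S) reply) =
    resp (z , z∉D , z∉S ∘ S₀⊆S) reply₀
    where
    -- A Staller move already in S is answered as if she had played z.
    reply₀ : ∀ v → v ∉ D → v ∉ S₀ → DWinD G k D (S₀ ∪ ⁅ v ⁆)
    reply₀ v v∉D _ with v ∈? S
    ... | no v∉S =
      DWinD-antimono (∪⁅⁆-least (p⊆p∪q ⁅ v ⁆ ∘ S₀⊆S) (x∈p∪⁅x⁆ S v)) (reply v v∉D v∉S)
    ... | yes v∈S =
      DWinD-antimono (p⊆p∪q ⁅ z ⁆ ∘ ∪⁅⁆-least S₀⊆S v∈S) (reply z z∉D z∉S)

  DWinD-mono : ∀ {k k' D S} → k ≤ k' → DWinD G k D S → DWinD G k' D S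
  DWinS-mono : ∀ {k k' D S} → k ≤ k' → DWinS G k D S → DWinS G k' D S
  DWinD-mono _ (won w) = won w
  DWinD-mono (s≤s k≤k') (move v v∉D v∉S t) = move v v∉D v∉S (DWinS-mono k≤k' t)
  DWinS-mono _ (won w) = won w
  DWinS-mono k≤k' (resp free reply) =
    resp free (λ v v∉D v∉S → DWinD-mono k≤k' (reply v v∉D v∉S))

  DWinS-reply : ∀ {k D S v} → DWinS G k D S → v ∉ D → v ∉ S → DWinD G k D (S ∪ ⁅ v ⁆)
  DWinS-reply (won w) _ _ = won w
  DWinS-reply (resp _ reply) v∉D v∉S = reply _ v∉D v∉S

  DWinS⇒DWinD : ∀ {k D S} → DWinS G k D S → DWinD G k D S
  DWinS⇒DWinD (won w) = won w
  DWinS⇒DWinD (resp (z , z∉D , z∉S) reply) = DWinD-antimono (p⊆p∪q ⁅ z ⁆) (reply z z∉D z∉S)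

  DomWon⇒StallerNotWon : ∀ {D S} → DomWon G D → StallerNotWon G D S
  DomWon⇒StallerNotWon {S = S} (X , dom , X⊆D) = X , dom , X⊆D ∘ p∩q⊆p X S

  DWinD⇒StallerNotWon : ∀ {k D S} → DWinD G k D S → StallerNotWon G D S
  DWinS⇒StallerNotWon : ∀ {k D S} → DWinS G k D S → StallerNotWon G D S
  DWinD⇒StallerNotWon (won w) = DomWon⇒StallerNotWon w
  DWinD⇒StallerNotWon {D = D} {S} (move v _ v∉S t) with DWinS⇒StallerNotWon t
  ... | X , dom , X∩S⊆D∪v = X , dom , λ x∈ →
    [ id , ⊥-elim ∘ ∈∧∉⇒≢ (p∩q⊆q X S x∈) v∉S ∘ x∈⁅y⁆⇒x≡y v ]
      (x∈p∪q⁻ D ⁅ v ⁆ (X∩S⊆D∪v x∈))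
  DWinS⇒StallerNotWon (won w) = DomWon⇒StallerNotWon w
  DWinS⇒StallerNotWon {S = S} (resp (z , z∉D , z∉S) reply)
    with DWinD⇒StallerNotWon (reply z z∉D z∉S)
  ... | X , dom , X∩S∪z⊆D = X , dom , λ x∈ →
    X∩S∪z⊆D (x∈p∩q⁺ (p∩q⊆p X S x∈ , p⊆p∪q ⁅ z ⁆ (p∩q⊆q X S x∈)))

module Corona (H : Graph) where

  G : Graph
  G = K₂ ⊙ H

  centre : Fin 2 → Fin (n G)
  centre c = c ↑ˡ (2 * n H)

  copy : Fin 2 → Fin (n H) → Fin (n G)
  copy c h = 2 ↑ʳ combine c h

  data View : Fin (n G) → Set where
    centreᵛ : ∀ c → View (centre c)
    copyᵛ   : ∀ c h → View (copy c h)

  view : ∀ v → View v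
  view 0F = centreᵛ 0F
  view 1F = centreᵛ 1F
  view (suc (suc x)) =
    subst (λ y → View (suc (suc y))) (combine-remQuot {2} (n H) x)
      (uncurry copyᵛ (remQuot {2} (n H) x))

  centre-outside-copy : ∀ c' c h → copy c h ≢ centre c'
  centre-outside-copy 0F _ _ ()
  centre-outside-copy 1F _ _ ()

  copy-injective : ∀ {c c' h h'} → copy c h ≡ copy c' h' → c ≡ c' × h ≡ h'
  copy-injective {c} {c'} {h} {h'} eq =
    combine-injectiveˡ c h c' h' combine≡ , combine-injectiveʳ c h c' h' combine≡
    where combine≡ = ↑ʳ-injective 2 _ _ eq

  copy₀≢copy₁ : ∀ h h' → copy 0F h ≢ copy 1F h'
  copy₀≢copy₁ h h' eq with () ← proj₁ (copy-injective {0F} {1F} {h} {h'} eq)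

  copy? : ∀ c v → (∃ λ h → copy c h ≡ v) ⊎ (∀ h → copy c h ≢ v)
  copy? c v = decide (view v)
    where
    decide : ∀ {v} → View v → (∃ λ h → copy c h ≡ v) ⊎ (∀ h → copy c h ≢ v)
    decide (centreᵛ c') = inj₂ (centre-outside-copy c' c)
    decide (copyᵛ c' h) with c ≟ c'
    ... | yes refl = inj₁ (h , refl)
    ... | no c≢c' = inj₂ (λ h' → c≢c' ∘ proj₁ ∘ copy-injective)

  untouched-side : ∀ x → ∃ λ c → centre c ≢ x × (∀ h → copy c h ≢ x)
  untouched-side x = choose (view x)
    where
    choose : ∀ {x} → View x → ∃ λ c → centre c ≢ x × (∀ h → copy c h ≢ x)
    choose (centreᵛ 0F) = 1F , (λ ()) , centre-outside-copy 0F 1F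
    choose (centreᵛ 1F) = 0F , (λ ()) , centre-outside-copy 1F 0F
    choose (copyᵛ 0F h) = 1F , (λ ()) , (λ h' → copy₀≢copy₁ h h' ∘ sym)
    choose (copyᵛ 1F h) = 0F , (λ ()) , (λ h' → copy₀≢copy₁ h' h)

  adj-centre-copy : ∀ c c' h → adj G (centre c) (copy c' h) ≡ (c == c')
  adj-centre-copy 0F c' h = cong (λ r → 0F == proj₁ r) (remQuot-combine {2} {n H} c' h)
  adj-centre-copy 1F c' h = cong (λ r → 1F == proj₁ r) (remQuot-combine {2} {n H} c' h)

  adj-copy-copy : ∀ c c' h h' → adj G (copy c h) (copy c' h') ≡ ((c == c') ∧ adj H h h')
  adj-copy-copy c c' h h' = cong₂ (λ r r' → (proj₁ r == proj₁ r') ∧ adj H (proj₂ r) (proj₂ r'))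
    (remQuot-combine {2} {n H} c h) (remQuot-combine {2} {n H} c' h')

  centre-adj-copy : ∀ c h → Adj G (centre c) (copy c h)
  centre-adj-copy c h = trans (adj-centre-copy c c h) (==-refl c)

  copy-adj : ∀ c {h h'} → Adj H h h' → Adj G (copy c h) (copy c h')
  copy-adj c {h} {h'} h~h' = trans (adj-copy-copy c c h h') (cong₂ _∧_ (==-refl c) h~h')

  Adj-centre-copy⁻ : ∀ {c c' h} → Adj G (centre c') (copy c h) → c' ≡ c
  Adj-centre-copy⁻ {c} {c'} {h} c'~ = ==⇒≡ (trans (sym (adj-centre-copy c' c h)) c'~)

  Adj-copy-copy⁻ : ∀ {c c' h h'} → Adj G (copy c' h') (copy c h) → c' ≡ c × Adj H h' h
  Adj-copy-copy⁻ {c} {c'} {h} {h'} c'h'~ =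
    ==⇒≡ (∧-conicalˡ (c' == c) _ both) , ∧-conicalʳ (c' == c) _ both
    where both = trans (sym (adj-copy-copy c' c h' h)) c'h'~

  neighbour-of-copy : ∀ c {u h} → Adj G u (copy c h) →
                      u ≡ centre c ⊎ ∃ λ h' → u ≡ copy c h' × Adj H h' h
  neighbour-of-copy c {u} = classify (view u)
    where
    classify : ∀ {u h} → View u → Adj G u (copy c h) →
               u ≡ centre c ⊎ ∃ λ h' → u ≡ copy c h' × Adj H h' h
    classify (centreᵛ c') u~ with refl ← Adj-centre-copy⁻ {c} {c'} u~ = inj₁ refl
    classify {h = h} (copyᵛ c' h') u~ with refl , h'~h ← Adj-copy-copy⁻ {c} {c'} {h} {h'} u~ =
      inj₂ (h' , refl , h'~h)

  Dominating-centres : ∀ {D} → centre 0F ∈ D → centre 1F ∈ D → Dominating G D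
  Dominating-centres {D} c₀∈D c₁∈D v = dominate (view v)
    where
    centre∈D : ∀ c → centre c ∈ D
    centre∈D 0F = c₀∈D
    centre∈D 1F = c₁∈D
    dominate : ∀ {v} → View v → v ∈ D ⊎ ∃ λ u → u ∈ D × Adj G u v
    dominate (centreᵛ c) = inj₁ (centre∈D c)
    dominate (copyᵛ c h) = inj₂ (centre c , centre∈D c , centre-adj-copy c h)

  Dominating-extend : ∀ {D} → centre 0F ∈ D → Dominating H (preimage (copy 1F) D) →
                      Dominating G D
  Dominating-extend {D} c₀∈D dom v = dominate (view v)
    where
    dominate : ∀ {v} → View v → v ∈ D ⊎ ∃ λ u → u ∈ D × Adj G u v
    dominate (centreᵛ 0F) = inj₁ c₀∈D
    dominate (centreᵛ 1F) = inj₂ (centre 0F , c₀∈D , refl)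
    dominate (copyᵛ 0F h) = inj₂ (centre 0F , c₀∈D , centre-adj-copy 0F h)
    dominate (copyᵛ 1F h) with dom h
    ... | inj₁ h∈D = inj₁ (∈-preimage⁻ (copy 1F) h∈D)
    ... | inj₂ (h' , h'∈D , h'~h) =
      inj₂ (copy 1F h' , ∈-preimage⁻ (copy 1F) h'∈D , copy-adj 1F h'~h)

  Dominating-restrict : ∀ {c X} → centre c ∉ X → Dominating G X →
                        Dominating H (preimage (copy c) X)
  Dominating-restrict {c} {X} c∉X dom h with dom (copy c h)
  ... | inj₁ ch∈X = inj₁ (∈-preimage⁺ (copy c) ch∈X)
  ... | inj₂ (u , u∈X , u~ch) with neighbour-of-copy c {u} u~ch
  ...   | inj₁ refl = ⊥-elim (c∉X u∈X)
  ...   | inj₂ (h' , refl , h'~h) = inj₂ (h' , ∈-preimage⁺ (copy c) u∈X , h'~h)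

  Dominating-claimed-copy : ∀ {c D S} → centre c ∈ S → centre c ∉ D →
                            ¬ (∃ λ h → h ∉ preimage (copy c) D × h ∉ preimage (copy c) S) →
                            StallerNotWon G D S → Dominating H (preimage (copy c) D)
  Dominating-claimed-copy {c} {D} {S} c∈S c∉D claimed (X , dom , X∩S⊆D) =
    Dominating-mono H X⊆D (Dominating-restrict c∉X dom)
    where
    c∉X : centre c ∉ X
    c∉X c∈X = c∉D (X∩S⊆D (x∈p∩q⁺ (c∈X , c∈S)))
    X⊆D : preimage (copy c) X ⊆ preimage (copy c) D
    X⊆D {h} h∈X with h ∈? preimage (copy c) D | h ∈? preimage (copy c) S
    ... | yes h∈D | _ = h∈D
    ... | no _ | yes h∈S =
      ∈-preimage⁺ (copy c)
        (X∩S⊆D (x∈p∩q⁺ (∈-preimage⁻ (copy c) h∈X , ∈-preimage⁻ (copy c) h∈S)))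
    ... | no h∉D | no h∉S = ⊥-elim (claimed (h , h∉D , h∉S))

  ¬DomWon-∅ : ¬ DomWon G ∅
  ¬DomWon-∅ = ¬Dominating-∅ G (centre 0F) ∘ DomWon⇒Dominating G

  preimage-copy-∪-copy : ∀ c D h →
                         preimage (copy c) (D ∪ ⁅ copy c h ⁆) ≡ preimage (copy c) D ∪ ⁅ h ⁆
  preimage-copy-∪-copy c = preimage-∪-image (copy c) (λ eq → proj₂ (copy-injective {c} {c} eq))

  module _ {c : Fin 2} where

    DWinD-restrict : ∀ {j D S} → centre c ∈ S → centre c ∉ D → DWinD G j D S →
                     DWinD H j (preimage (copy c) D) (preimage (copy c) S)
    DWinS-restrict : ∀ {j D S} → centre c ∈ S → centre c ∉ D → DWinS G j D S →
                     DWinS H j (preimage (copy c) D) (preimage (copy c) S)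
    DWinD-restrict c∈S c∉D (won w) =
      won (Dominating⇒DomWon H (Dominating-restrict c∉D (DomWon⇒Dominating G w)))
    DWinD-restrict {D = D} c∈S c∉D (move v v∉D v∉S t) with copy? c v
    ... | inj₁ (h , refl) =
      move h (v∉D ∘ ∈-preimage⁻ (copy c)) (v∉S ∘ ∈-preimage⁻ (copy c))
        (subst (λ D' → DWinS H _ D' _) (preimage-copy-∪-copy c D h)
          (DWinS-restrict c∈S (∉-∪⁅⁆ c∉D (∈∧∉⇒≢ c∈S v∉S)) t))
    ... | inj₂ v∉copy =
      DWinD-mono (n≤1+n _) (DWinS⇒DWinD
        (subst (λ D' → DWinS H _ D' _) (preimage-∪-outside (copy c) D v∉copy)
          (DWinS-restrict c∈S (∉-∪⁅⁆ c∉D (∈∧∉⇒≢ c∈S v∉S)) t)))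
    DWinS-restrict c∈S c∉D (won w) =
      won (Dominating⇒DomWon H (Dominating-restrict c∉D (DomWon⇒Dominating G w)))
    DWinS-restrict {D = D} {S} c∈S c∉D t@(resp _ reply)
      with any? (λ h → ¬? (h ∈? preimage (copy c) D) ×-dec ¬? (h ∈? preimage (copy c) S))
    ... | yes free = resp free λ h h∉D h∉S →
      subst (DWinD H _ _) (preimage-copy-∪-copy c S h)
        (DWinD-restrict (p⊆p∪q ⁅ copy c h ⁆ c∈S) c∉D
          (reply (copy c h) (h∉D ∘ ∈-preimage⁺ (copy c)) (h∉S ∘ ∈-preimage⁺ (copy c))))
    ... | no claimed =
      won (Dominating⇒DomWon H (Dominating-claimed-copy c∈S c∉D claimed (DWinS⇒StallerNotWon t)))

  DWinD-extend : ∀ {j D S} → centre 0F ∈ D →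
                 DWinD H j (preimage (copy 1F) D) (preimage (copy 1F) S) → DWinD G j D S
  DWinS-extend : ∀ {j D S} → centre 0F ∈ D →
                 DWinS H j (preimage (copy 1F) D) (preimage (copy 1F) S) → DWinS G j D S
  DWinD-extend c₀∈D (won w) =
    won (Dominating⇒DomWon G (Dominating-extend c₀∈D (DomWon⇒Dominating H w)))
  DWinD-extend {D = D} c₀∈D (move h h∉D h∉S t) =
    move (copy 1F h) (h∉D ∘ ∈-preimage⁺ (copy 1F)) (h∉S ∘ ∈-preimage⁺ (copy 1F))
      (DWinS-extend (p⊆p∪q ⁅ copy 1F h ⁆ c₀∈D)
        (subst (λ D' → DWinS H _ D' _) (sym (preimage-copy-∪-copy 1F D h)) t))
  DWinS-extend c₀∈D (won w) =
    won (Dominating⇒DomWon G (Dominating-extend c₀∈D (DomWon⇒Dominating H w)))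
  DWinS-extend {j} {D} {S} c₀∈D t@(resp (z , z∉D , z∉S) reply) =
    resp (copy 1F z , z∉D ∘ ∈-preimage⁺ (copy 1F) , z∉S ∘ ∈-preimage⁺ (copy 1F)) reply'
    where
    reply' : ∀ v → v ∉ D → v ∉ S → DWinD G j D (S ∪ ⁅ v ⁆)
    reply' v v∉D v∉S with copy? 1F v
    ... | inj₁ (h , refl) =
      DWinD-extend c₀∈D (subst (DWinD H j _) (sym (preimage-copy-∪-copy 1F S h))
        (reply h (v∉D ∘ ∈-preimage⁻ (copy 1F)) (v∉S ∘ ∈-preimage⁻ (copy 1F))))
    ... | inj₂ v∉copy =
      DWinD-extend c₀∈D (subst (DWinD H j _) (sym (preimage-∪-outside (copy 1F) S v∉copy))
        (DWinS⇒DWinD t))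

  DWinD-corona⁺ : ∀ {k} → DWinD H k ∅ ∅ → DWinD G (suc k) ∅ ∅
  DWinD-corona⁺ w = move (centre 0F) ∉⊥ ∉⊥ (after-x₀ w)
    where
    D₀ : Subset (n G)
    D₀ = ∅ ∪ ⁅ centre 0F ⁆
    c₀∈D₀ : centre 0F ∈ D₀
    c₀∈D₀ = x∈p∪⁅x⁆ ∅ (centre 0F)
    c₁∉D₀ : centre 1F ∉ D₀
    c₁∉D₀ = ∉-∪⁅⁆ {v = centre 0F} {p = ∅} ∉⊥ (λ ())
    trace-D₀ : preimage (copy 1F) D₀ ≡ ∅
    trace-D₀ = preimage-⁅outside⁆ (copy 1F) (centre-outside-copy 0F 1F)
    trace-x₁ : preimage (copy 1F) (∅ ∪ ⁅ centre 1F ⁆) ≡ ∅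
    trace-x₁ = preimage-⁅outside⁆ (copy 1F) (centre-outside-copy 1F 1F)
    after-x₀ : ∀ {k} → DWinD H k ∅ ∅ → DWinS G k D₀ ∅
    after-x₀ (won w) =
      won (Dominating⇒DomWon G (Dominating-extend c₀∈D₀
        (subst (Dominating H) (sym trace-D₀) (DomWon⇒Dominating H w))))
    after-x₀ {suc k} w@(move _ _ _ _) = resp (centre 1F , c₁∉D₀ , ∉⊥) reply
      where
      reply : ∀ v → v ∉ D₀ → v ∉ ∅ → DWinD G (suc k) D₀ (∅ ∪ ⁅ v ⁆)
      reply v _ _ with v ≟ centre 1F
      ... | yes refl = DWinD-extend c₀∈D₀ (subst₂ (DWinD H _) (sym trace-D₀) (sym trace-x₁) w)
      ... | no v≢c₁ =
        move (centre 1F) c₁∉D₀ (∉-∪⁅⁆ {p = ∅} ∉⊥ (v≢c₁ ∘ sym))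
          (won (Dominating⇒DomWon G
            (Dominating-centres (p⊆p∪q ⁅ centre 1F ⁆ c₀∈D₀) (x∈p∪⁅x⁆ D₀ (centre 1F)))))

  DWinD-corona⁻ : ∀ {j} → DWinD G (suc j) ∅ ∅ → DWinD H j ∅ ∅
  DWinD-corona⁻ (won w) = ⊥-elim (¬DomWon-∅ w)
  DWinD-corona⁻ (move x _ _ t) with untouched-side x
  ... | c , c≢x , x∉copy =
    subst₂ (DWinD H _) (preimage-⁅outside⁆ (copy c) x∉copy)
      (preimage-⁅outside⁆ (copy c) (centre-outside-copy c c))
      (DWinD-restrict (x∈p∪⁅x⁆ ∅ (centre c)) (∉-∪⁅⁆ ∉⊥ c≢x)
        (DWinS-reply t (∉-∪⁅⁆ ∉⊥ c≢x) ∉⊥))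

corollary3p7 : (H : Graph) → IsSimple H → OutcomeD H →
    (k : ℕ) → IsGammaMB H k → IsGammaMB (K₂ ⊙ H) (suc k)
corollary3p7 H _ _ k (winH , minimalH) = DWinD-corona⁺ winH , minimal
  where
  open Corona H
  minimal : ∀ j → DWinD G j ∅ ∅ → suc k ≤ j
  minimal zero (won w) = ⊥-elim (¬DomWon-∅ w)
  minimal (suc j) w = s≤s (minimalH j (DWinD-corona⁻ w))
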